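{- Given a linear list of distinct values, there is a unique path-decomposed binary tree satisfying Conditions I.1, I.2 and II, and a resulting unique banana tree satisfying Conditions III.1 and III.2.
   Context: The list $c_1,\dots,c_m$ of distinct reals defines the piecewise linear map $f$ with $f(i)=c_i$ (plus hooks at $0$ and $m+1$, $f(0)=c_1+\varepsilon\,\mathrm{sign}(c_2-c_1)$, $f(m+1)=c_m+\varepsilon\,\mathrm{sign}(c_{m-1}-c_m)$, tiny $\varepsilon>0$). Its critical items (local minima and maxima) are the nodes; a special root $\beta$ is added, greater than every item in value and position, whose only child is the root of the full binary tree on the other critical items. Condition I.1: the in-order sequence of nodes of the full binary tree is the order of the critical items by position. Condition I.2: values increase along every leaf-to-root path. Condition II: the edges are decomposed into paths, each connecting a leaf $a$ to its nearest ancestor $b$ for which $a$ does not have the smallest value in the subtree of $b$, or to the special root if no such ancestor exists. A banana tree is obtained by splitting each path $a=q_0,\dots,q_\ell=b$ into two trails starting at $a$ and ending at $b$: for $a<b$, the in-trail consists of $a$, every $q_i$ whose right child is $q_{i-1}$, and $b$; the mid-trail consists of $a$, every $q_i$ whose left child is $q_{i-1}$, and $b$ (roles of left/right reversed for $a>b$; for $\beta$ the left trail is called in-trail). Condition III.1 (for $a<b$): if $a=u_0,u_1,\dots,u_j=b$ are the nodes of the in-trail then $u_i>u_{i+1}$ for $0\le i\le j-2$ and $f(u_i)<f(u_{i+1})$ for $0\le i\le j-1$. Condition III.2 (for $a<b$): if $a=v_0,\dots,v_k=b$ are the nodes of the mid-trail then $v_i<v_{i+1}$ and $f(v_i)<f(v_{i+1})$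 for $0\le i\le k-1$. (Symmetric conditions for $a>b$.) -}

module Defs where

open import Level using (Level; _⊔_)
open import Data.Nat using (ℕ; zero; suc; _≤_; _<_; _>_; _∸_; _+_; _≤?_; _≟_)
open import Data.Product using (Σ; ∃; _×_; _,_; proj₁; proj₂)
open import Data.Sum using (_⊎_)
open import Data.Unit using (⊤)
open import Data.Empty using (⊥)
open import Data.Maybe using (Maybe; just; nothing)
open import Data.List using (List; []; _∷_; _++_; [_]; reverse; map; zip; length; lookup)
open import Data.List.Membership.Propositional using (_∈_)
open import Data.List.Relation.Unary.All using (All)
open import Data.List.Relation.Unary.Linked using (Linked)
open import Data.List.Relation.Binary.Pointwise using (Pointwise)
open import Data.Fin using (Fin)
open import Relation.Nullary using (¬_; yes; no)
open import Relation.Binary using (Tri; tri<; tri≈; tri>)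
open import Relation.Binary.Bundles using (StrictTotalOrder)
open import Relation.Binary.PropositionalEquality using (_≡_)

-- Full binary trees whose nodes are labelled by positions (ℕ).

data BT : Set where
  lf : ℕ → BT
  nd : BT → ℕ → BT → BT

inorder : BT → List ℕ
inorder (lf x)     = [ x ]
inorder (nd l x r) = inorder l ++ x ∷ inorder r

leaves : BT → List ℕ
leaves (lf x)     = [ x ]
leaves (nd l x r) = leaves l ++ leaves r

root : BT → ℕ
root (lf x)     = x
root (nd l x r) = x

-- which child of a node the path comes from
data Side : Set where
  L R : Side

-- path from the root down to (but excluding) node a; each entry is a
-- proper ancestor q of a together with the side (L/R) of the child of q
-- lying on the path to a.  nothing if a is not a node of the tree.
downPath : BT → ℕ → Maybe (List (ℕ × Side))
downPath (lf x) a with x ≟ a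
... | yes _ = just []
... | no _  = nothing
downPath (nd l x r) a with x ≟ a
... | yes _ = just []
... | no _ with downPath l a
...   | just p  = just ((x , L) ∷ p)
...   | nothing with downPath r a
...     | just p  = just ((x , R) ∷ p)
...     | nothing = nothing

subtreeAt : BT → ℕ → Maybe BT
subtreeAt (lf x) b with x ≟ b
... | yes _ = just (lf x)
... | no _  = nothing
subtreeAt (nd l x r) b with x ≟ b
... | yes _ = just (nd l x r)
... | no _ with subtreeAt l b
...   | just s  = just s
...   | nothing = subtreeAt r b

-- nodes q_i (i ≥ 1, excluding the last) of a path whose predecessor
-- q_{i-1} is the child on side s
sel : Side → List (ℕ × Side) → List ℕ
sel s [] = []
sel L ((q , L) ∷ xs) = q ∷ sel L xs
sel L ((q , R) ∷ xs) = sel L xs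
sel R ((q , L) ∷ xs) = sel R xs
sel R ((q , R) ∷ xs) = q ∷ sel R xs

data Sgn : Set where
  neg zer pos : Sgn

data _<S_ : Sgn → Sgn → Set where
  n<z : neg <S zer
  n<p : neg <S pos
  z<p : zer <S pos

-- Everything below depends on the totally ordered value domain (the
-- reals are only used through their order), the length m and the list
-- c (c i = c_i for 1 ≤ i ≤ m; other values of c are irrelevant).

module Banana {a ℓ₁ ℓ₂} (O : StrictTotalOrder a ℓ₁ ℓ₂) (m : ℕ)
              (c : ℕ → StrictTotalOrder.Carrier O) where

  open StrictTotalOrder O using (_≈_; compare) renaming (Carrier to A; _<_ to _<ᴬ_)

  -- values of f: a real plus an infinitesimal multiple (-1,0,1) of ε,
  -- or the value of the special root β (above everything)
  data Ext : Set a where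
    val : A → Sgn → Ext
    top : Ext

  -- order for a tiny ε > 0 (lexicographic)
  data _<E_ : Ext → Ext → Set (a ⊔ ℓ₁ ⊔ ℓ₂) where
    v<v   : ∀ {x y s t} → x <ᴬ y → val x s <E val y t
    v≈v   : ∀ {x y s t} → x ≈ y → s <S t → val x s <E val y t
    v<top : ∀ {x s} → val x s <E top

  sgn : A → A → Sgn
  sgn x y with compare x y
  ... | tri< _ _ _ = pos
  ... | tri≈ _ _ _ = zer
  ... | tri> _ _ _ = neg

  -- position of the special root β: greater than every item position
  β : ℕ
  β = suc (suc m)

  -- the map f on positions 0 … m+1 (hooks at 0 and m+1), f β = top
  f : ℕ → Ext
  f zero = val (c 1) (sgn (c 1) (c 2))
  f (suc n) with suc n ≤? m
  ... | yes _ = val (c (suc n)) zer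
  ... | no _ with suc n ≟ suc m
  ...   | yes _ = val (c m) (sgn (c m) (c (m ∸ 1)))
  ...   | no _  = top

  data Critical : ℕ → Set (a ⊔ ℓ₁ ⊔ ℓ₂) where
    intMin  : ∀ n → 1 ≤ n → n ≤ m → f n <E f (n ∸ 1) → f n <E f (suc n) → Critical n
    intMax  : ∀ n → 1 ≤ n → n ≤ m → f (n ∸ 1) <E f n → f (suc n) <E f n → Critical n
    hookMin₀ : f 0 <E f 1 → Critical 0
    hookMinₘ : f (suc m) <E f m → Critical (suc m)

  CondI1 : BT → Set (a ⊔ ℓ₁ ⊔ ℓ₂)
  CondI1 t = Linked _<_ (inorder t) × (∀ n → (n ∈ inorder t → Critical n) × (Critical n → n ∈ inorder t))

  -- Condition I.2: values increase along every leaf-to-root path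
  -- (the edge from the root to β holds automatically: f β = top)
  CondI2 : BT → Set (a ⊔ ℓ₁ ⊔ ℓ₂)
  CondI2 (lf x)     = Level.Lift _ ⊤
  CondI2 (nd l x r) = f (root l) <E f x × f (root r) <E f x × CondI2 l × CondI2 r

  -- proper ancestors of a (nearest first, with the side of the path),
  -- followed by the special root β
  up : BT → ℕ → List (ℕ × Side)
  up t x with downPath t x
  ... | just p  = reverse p ++ [ (β , L) ]
  ... | nothing = []

  NotMin : BT → ℕ → ℕ → Set (a ⊔ ℓ₁ ⊔ ℓ₂)
  NotMin t x b = Σ BT λ s → subtreeAt t b ≡ just s × Σ ℕ λ y → y ∈ inorder s × f y <E f x

  -- Condition II for a single path: b is the nearest ancestor of the
  -- leaf x for which x is not the smallest of b's subtree, or β if there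
  -- is none
  Partner : BT → ℕ → ℕ → Set (a ⊔ ℓ₁ ⊔ ℓ₂)
  Partner t x b = Σ (List (ℕ × Side)) λ pre → Σ Side λ s → Σ (List (ℕ × Side)) λ post →
      up t x ≡ pre ++ (b , s) ∷ post
    × All (λ q → ¬ NotMin t x (proj₁ q)) pre
    × (NotMin t x b ⊎ (b ≡ β × post ≡ []))

  -- the edge from node y to its parent lies on the path from leaf x to b
  OnPath : BT → ℕ × ℕ → ℕ → Set
  OnPath t (x , b) y = Σ (List (ℕ × Side)) λ pre → Σ Side λ s → Σ (List (ℕ × Side)) λ post →
      up t x ≡ pre ++ (b , s) ∷ post × (y ≡ x ⊎ y ∈ map proj₁ pre)

  -- A path decomposition is given by one path per leaf (listed in the
  -- left-to-right order of the leaves), recorded by its upper endpoint.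
  -- Condition II: each path goes from its leaf to the prescribed
  -- ancestor, and the paths partition the edges (every node y has its
  -- edge to the parent, possibly β, in exactly one path).
  CondII : BT → List ℕ → Set (a ⊔ ℓ₁ ⊔ ℓ₂)
  CondII t D = Pointwise (Partner t) (leaves t) D
    × (∀ y → y ∈ inorder t →
         Σ (Fin (length (zip (leaves t) D))) λ k →
           OnPath t (lookup (zip (leaves t) D) k) y
           × (∀ k′ → OnPath t (lookup (zip (leaves t) D) k′) y → k′ ≡ k))

  -- Conditions III.1 and III.2 for the path from leaf x to b, where the
  -- path is x = q₀, q₁, … , q_ℓ = b and the entries of pre are q₁ … q_{ℓ-1}
  -- with the side of q_{i-1} below q_i.
  TrailConds : ℕ → ℕ → List (ℕ × Side) → Set (a ⊔ ℓ₁ ⊔ ℓ₂)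
  TrailConds x b pre =
      (x < b →
          -- in-trail: x, q_i whose right child is q_{i-1}, b
          (Linked _>_ (x ∷ sel R pre) × Linked (λ u v → f u <E f v) (x ∷ sel R pre ++ [ b ]))
          -- mid-trail: x, q_i whose left child is q_{i-1}, b
        × Linked (λ u v → u < v × f u <E f v) (x ∷ sel L pre ++ [ b ]))
    × (b < x →
          (Linked _<_ (x ∷ sel L pre) × Linked (λ u v → f u <E f v) (x ∷ sel L pre ++ [ b ]))
        × Linked (λ u v → u > v × f u <E f v) (x ∷ sel R pre ++ [ b ]))

  CondIII : BT → List ℕ → Set (a ⊔ ℓ₁ ⊔ ℓ₂)
  CondIII t D = ∀ x b → (x , b) ∈ zip (leaves t) D →
    ∀ pre s post → up t x ≡ pre ++ (b , s) ∷ post → TrailConds x b pre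

{-# OPTIONS --safe #-}
module Submission where

-- The critical items alternate between minima and maxima, starting and ending with a minimum, and
-- f separates them (the c_i are distinct and the hooks carry a nonzero ε-sign). Conditions I.1
-- and I.2 say that the tree is a search tree in position and a heap in value, i.e. the Cartesian
-- tree of the critical items: it is unique, since its root is the maximum and the in-order
-- sequence splits there, and it is built by a left-to-right scan that hangs every maximum,
-- together with the minimum following it, onto the right spine. The path of a leaf a climbs
-- exactly as long as a is the minimum of the current subtree, so the edge above a node y lies on
-- the path of the minimum leaf of y's subtree and on no other; this gives Condition II and the
-- uniqueness of the decomposition. Along any ancestor chain each ancestor lies on a fixed side of
-- everything below it and has a larger value, which is all that Conditions III.1 and III.2 ask.

open import Defs
open import Level using (Level; _⊔_; Lift; lift)
open import Data.Bool using (Bool; true; false)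
open import Data.Empty using (⊥-elim)
open import Data.Fin using (Fin) renaming (zero to fzero; suc to fsuc)
open import Data.Maybe using (just; nothing)
open import Data.Maybe.Properties using (just-injective)
open import Data.Nat using (ℕ; zero; suc; _≤_; _<_; _∸_; _≤?_; _≟_; z≤n; s≤s)
open import Data.Nat.Properties
  using (≤-refl; ≤-trans; <-irrefl; <-asym; <-trans; <⇒≢; <⇒≤; n<1+n; m≤n⇒m≤1+n; ≤∧≢⇒<; ≤-pred;
         ∸-monoˡ-≤; ∸-monoʳ-<; m∸n≤m; m≤n⇒m<n∨m≡n; m<1+n⇒m<n∨m≡n; m<n⇒m<1+n)
open import Data.Product using (Σ; _×_; _,_; proj₁; proj₂)
import Data.Product as Product
open import Data.Sum using (_⊎_; inj₁; inj₂)
import Data.Sum as Sum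
open import Data.Unit using (⊤; tt)
open import Data.List using (List; []; _∷_; _++_; [_]; reverse; map; zip; length; lookup)
open import Data.List.Properties
  using (unfold-reverse; reverse-++; ++-assoc; ∷-injective; ∷-injectiveˡ; ∷-injectiveʳ; ++-conicalʳ; ∷ʳ-injective)
open import Data.List.Membership.Propositional using (_∈_; find; lose)
open import Data.List.Membership.Propositional.Properties using (∈-++⁺ˡ; ∈-++⁺ʳ; ∈-++⁻; ∈-map⁺; ∈-map⁻)
open import Data.List.Relation.Unary.Any using (Any; here; there; any?)
import Data.List.Relation.Unary.Any.Properties as Any
open import Data.List.Relation.Unary.All as All using (All; []; _∷_)
import Data.List.Relation.Unary.All.Properties as All
open import Data.List.Relation.Unary.AllPairs as AllPairs using (AllPairs; []; _∷_)
import Data.List.Relation.Unary.AllPairs.Properties as AllPairs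
open import Data.List.Relation.Unary.Linked using (Linked)
open import Data.List.Relation.Unary.Linked.Properties using (AllPairs⇒Linked; Linked⇒AllPairs)
open import Data.List.Relation.Binary.Pointwise as Pointwise using (Pointwise; []; _∷_; Pointwise-≡⇒≡)
open import Function using (id; flip; _∘_; _$_; _on_)
open import Function.Bundles using (_⇔_; mk⇔; Equivalence)
open import Relation.Nullary using (¬_; yes; no; Dec; does)
import Relation.Nullary.Decidable as Dec
open import Relation.Unary using (Decidable)
open import Relation.Binary using (Rel; tri<; tri≈; tri>)
open import Relation.Binary.Bundles using (StrictTotalOrder)
open import Relation.Binary.PropositionalEquality
  using (_≡_; _≢_; refl; sym; trans; cong; cong₂; subst; module ≡-Reasoning)

private
  variable
    a p r : Level
    A B : Set a

All-reverse⁺ : {P : A → Set p} {xs : List A} → All P xs → All P (reverse xs)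
All-reverse⁺ pxs = All.tabulate (All.lookup pxs ∘ Any.reverse⁻)

module _ {R : Rel A r} where

  AllPairs-++⁻ : ∀ xs {ys} → AllPairs R (xs ++ ys) →
                 AllPairs R xs × AllPairs R ys × All (λ x → All (R x) ys) xs
  AllPairs-++⁻ []       rs       = [] , rs , []
  AllPairs-++⁻ (x ∷ xs) (r ∷ rs) with AllPairs-++⁻ xs rs
  ... | rxs , rys , rxsys = All.++⁻ˡ xs r ∷ rxs , rys , All.++⁻ʳ xs r ∷ rxsys

  AllPairs-reverse⁺ : ∀ {xs} → AllPairs R xs → AllPairs (flip R) (reverse xs)
  AllPairs-reverse⁺ {[]}     []       = []
  AllPairs-reverse⁺ {x ∷ xs} (r ∷ rs) rewrite unfold-reverse x xs =
    AllPairs.++⁺ (AllPairs-reverse⁺ rs) ([] ∷ []) (All.map (_∷ []) (All-reverse⁺ r))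

AllPairs-snoc⇒Linked : ∀ {R : Rel A r} {xs b} → AllPairs R xs → All (λ x → R x b) xs → Linked R (xs ++ [ b ])
AllPairs-snoc⇒Linked Rxs Rxsb = AllPairs⇒Linked (AllPairs.++⁺ Rxs ([] ∷ []) (All.map (_∷ []) Rxsb))

∈-zip⁻ˡ : ∀ xs (ys : List B) {x : A} {y} → (x , y) ∈ zip xs ys → x ∈ xs
∈-zip⁻ˡ (_ ∷ _)  (_ ∷ _)  (here refl) = here refl
∈-zip⁻ˡ (_ ∷ xs) (_ ∷ ys) (there x∈)  = there (∈-zip⁻ˡ xs ys x∈)

reverse-++-∷ : ∀ (xs : List A) x ys → reverse (xs ++ x ∷ ys) ≡ reverse ys ++ x ∷ reverse xs
reverse-++-∷ xs x ys = begin
  reverse (xs ++ x ∷ ys)                ≡⟨ reverse-++ xs (x ∷ ys) ⟩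
  reverse (x ∷ ys) ++ reverse xs        ≡⟨ cong (_++ reverse xs) (unfold-reverse x ys) ⟩
  (reverse ys ++ [ x ]) ++ reverse xs   ≡⟨ ++-assoc (reverse ys) [ x ] (reverse xs) ⟩
  reverse ys ++ x ∷ reverse xs          ∎
  where open ≡-Reasoning

strictlySorted-⊆⊇⇒≡ : ∀ {xs ys} → AllPairs _<_ xs → AllPairs _<_ ys →
                      (∀ {z} → z ∈ xs → z ∈ ys) → (∀ {z} → z ∈ ys → z ∈ xs) → xs ≡ ys
strictlySorted-⊆⊇⇒≡ {[]}     {[]}     _ _ _ _ = refl
strictlySorted-⊆⊇⇒≡ {[]}     {y ∷ ys} _ _ _ ys⊆ with () ← ys⊆ (here refl)
strictlySorted-⊆⊇⇒≡ {x ∷ xs} {[]}     _ _ xs⊆ _ with () ← xs⊆ (here refl)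
strictlySorted-⊆⊇⇒≡ {x ∷ xs} {y ∷ ys} (x<xs ∷ xs↗) (y<ys ∷ ys↗) xs⊆ ys⊆
  with minima-≡ (xs⊆ (here refl)) (ys⊆ (here refl))
  where
  minima-≡ : x ∈ y ∷ ys → y ∈ x ∷ xs → x ≡ y
  minima-≡ (here x≡y) _          = x≡y
  minima-≡ (there _)  (here y≡x) = sym y≡x
  minima-≡ (there x∈) (there y∈) = ⊥-elim (<-asym (All.lookup y<ys x∈) (All.lookup x<xs y∈))
... | refl = cong (x ∷_) (strictlySorted-⊆⊇⇒≡ xs↗ ys↗ (drop x<xs xs⊆) (drop y<ys ys⊆))
  where
  drop : ∀ {us vs} → All (x <_) us → (∀ {z} → z ∈ x ∷ us → z ∈ x ∷ vs) → ∀ {z} → z ∈ us → z ∈ vs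
  drop x<us ⊆ z∈us with ⊆ (there z∈us)
  ... | here refl  = ⊥-elim (<-irrefl refl (All.lookup x<us z∈us))
  ... | there z∈vs = z∈vs

∷-cancel-at : ∀ {z : A} xs {ys} xs′ {ys′} → All (_≢ z) xs → All (_≢ z) xs′ →
              xs ++ z ∷ ys ≡ xs′ ++ z ∷ ys′ → xs ≡ xs′ × ys ≡ ys′
∷-cancel-at []       []        _          _          refl = refl , refl
∷-cancel-at []       (_ ∷ _)   _          (x≢z ∷ _)  refl = ⊥-elim (x≢z refl)
∷-cancel-at (_ ∷ _)  []        (x≢z ∷ _)  _          refl = ⊥-elim (x≢z refl)
∷-cancel-at (x ∷ xs) (_ ∷ xs′) (_ ∷ xs≢) (_ ∷ xs′≢) eq with refl , eq′ ← ∷-injective eq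
  = Product.map₁ (cong (x ∷_)) (∷-cancel-at xs xs′ xs≢ xs′≢ eq′)

record FirstHit {a p} {A : Set a} (P : A → Set p) (xs : List A) : Set (a ⊔ p) where
  field
    before : List A
    hit    : A
    after  : List A
    split  : xs ≡ before ++ hit ∷ after
    misses : All (¬_ ∘ P) before
    stops  : P hit ⊎ after ≡ []

module _ {a p : Level} {A : Set a} {P : A → Set p} where

  first-hit-unique : ∀ pre {b post} pre′ {b′ post′} → pre ++ b ∷ post ≡ pre′ ++ b′ ∷ post′ →
                     All (¬_ ∘ P) pre → All (¬_ ∘ P) pre′ → P b ⊎ post ≡ [] → P b′ ⊎ post′ ≡ [] → b ≡ b′
  first-hit-unique []        []         refl _ _ _ _ = refl
  first-hit-unique []        (_ ∷ _)    eq   _ (¬Pb ∷ _) (inj₁ Pb) _ with refl ← ∷-injectiveˡ eq = ⊥-elim (¬Pb Pb)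
  first-hit-unique []        (_ ∷ pre′) eq   _ _ (inj₂ refl) _ with () ← ++-conicalʳ pre′ _ (sym (∷-injectiveʳ eq))
  first-hit-unique (_ ∷ _)   []         eq   (¬Pb′ ∷ _) _ _ (inj₁ Pb′) with refl ← ∷-injectiveˡ eq = ⊥-elim (¬Pb′ Pb′)
  first-hit-unique (_ ∷ pre) []         eq   _ _ _ (inj₂ refl) with () ← ++-conicalʳ pre _ (∷-injectiveʳ eq)
  first-hit-unique (_ ∷ pre) (_ ∷ pre′) eq (_ ∷ ¬Ps) (_ ∷ ¬Ps′) =
    first-hit-unique pre pre′ (∷-injectiveʳ eq) ¬Ps ¬Ps′

  module _ (P? : Decidable P) where

    firstHit : ∀ xs last → FirstHit P (xs ++ [ last ])
    firstHit []       last =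
      record { before = [] ; hit = last ; after = [] ; split = refl ; misses = [] ; stops = inj₂ refl }
    firstHit (x ∷ xs) last with P? x
    ... | yes Px =
      record { before = [] ; hit = x ; after = xs ++ [ last ] ; split = refl ; misses = [] ; stops = inj₁ Px }
    ... | no ¬Px = record { FirstHit h ; before = x ∷ FirstHit.before h ; split = cong (x ∷_) (FirstHit.split h)
                          ; misses = ¬Px ∷ FirstHit.misses h }
      where h = firstHit xs last

    firstHit-last : ∀ xs last → FirstHit.after (firstHit xs last) ≡ [] → FirstHit.hit (firstHit xs last) ≡ last
    firstHit-last xs last after≡[] with split ← FirstHit.split (firstHit xs last) rewrite after≡[] =
      sym (proj₂ (∷ʳ-injective xs _ split))

    firstHit-passes : ∀ pre y post last → All (¬_ ∘ P) pre → ¬ P y →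
                      y ∈ FirstHit.before (firstHit (pre ++ y ∷ post) last)
    firstHit-passes []       y post last _ ¬Py with P? y
    ... | yes Py = ⊥-elim (¬Py Py)
    ... | no _   = here refl
    firstHit-passes (x ∷ pre) y post last (¬Px ∷ ¬Ps) ¬Py with P? x
    ... | yes Px = ⊥-elim (¬Px Px)
    ... | no _   = there (firstHit-passes pre y post last ¬Ps ¬Py)

prefix-unique : (k : A → B) → ∀ pre {e post} pre′ {e′ post′} → AllPairs (_≢_ on k) (pre ++ e ∷ post) →
                pre ++ e ∷ post ≡ pre′ ++ e′ ∷ post′ → k e ≡ k e′ → pre ≡ pre′
prefix-unique k []        []         _         _  _  = refl
prefix-unique k []        (_ ∷ pre′) (ke≢ ∷ _) refl ke≡ = ⊥-elim (All.lookup ke≢ (∈-++⁺ʳ pre′ (here refl)) ke≡)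
prefix-unique k (_ ∷ pre) []         (ke≢ ∷ _) refl ke≡ = ⊥-elim (All.lookup ke≢ (∈-++⁺ʳ pre (here refl)) (sym ke≡))
prefix-unique k (x ∷ pre) (_ ∷ pre′) (_ ∷ ≢s) eq ke≡ with refl , eq′ ← ∷-injective eq
  = cong (x ∷_) (prefix-unique k pre pre′ ≢s eq′ ke≡)

module _ {R : A → B → Set r} where

  Pointwise-functional : (∀ {x y y′} → R x y → R x y′ → y ≡ y′) →
                         ∀ {xs ys ys′} → Pointwise R xs ys → Pointwise R xs ys′ → ys ≡ ys′
  Pointwise-functional R-functional rs rs′ =
    Pointwise-≡⇒≡ (Pointwise.transitive R-functional (Pointwise.symmetric id rs) rs′)

  All⇒Pointwise-map : (h : A → B) → ∀ {xs} → All (λ x → R x (h x)) xs → Pointwise R xs (map h xs)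
  All⇒Pointwise-map h []         = []
  All⇒Pointwise-map h (rx ∷ rxs) = rx ∷ All⇒Pointwise-map h rxs

module _ (h : A → B) where

  graph : List A → List (A × B)
  graph xs = zip xs (map h xs)

  lookup-zip-map : ∀ xs k → Σ A λ w → w ∈ xs × lookup (graph xs) k ≡ (w , h w)
  lookup-zip-map (x ∷ xs) fzero    = x , here refl , refl
  lookup-zip-map (x ∷ xs) (fsuc k) = Product.map₂ (Product.map₁ there) (lookup-zip-map xs k)

  index-zip-map : ∀ xs {w} → w ∈ xs → Σ (Fin (length (graph xs))) λ k → lookup (graph xs) k ≡ (w , h w)
  index-zip-map (x ∷ xs) (here refl) = fzero , refl
  index-zip-map (x ∷ xs) (there w∈)  with k , eq ← index-zip-map xs w∈ = fsuc k , eq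

  lookup-zip-map-injective : ∀ xs → AllPairs _≢_ xs → ∀ k k′ →
                             proj₁ (lookup (graph xs) k) ≡ proj₁ (lookup (graph xs) k′) → k ≡ k′
  lookup-zip-map-injective (x ∷ xs) _          fzero    fzero     _ = refl
  lookup-zip-map-injective (x ∷ xs) (x≢ ∷ _)  fzero    (fsuc k′) eq with lookup-zip-map xs k′
  ... | w , w∈ , lookup≡ = ⊥-elim (All.lookup x≢ w∈ (trans eq (cong proj₁ lookup≡)))
  lookup-zip-map-injective (x ∷ xs) (x≢ ∷ _)  (fsuc k) fzero     eq with lookup-zip-map xs k
  ... | w , w∈ , lookup≡ = ⊥-elim (All.lookup x≢ w∈ (trans (sym eq) (cong proj₁ lookup≡)))
  lookup-zip-map-injective (x ∷ xs) (_ ∷ ≢s) (fsuc k) (fsuc k′) eq =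
    cong fsuc (lookup-zip-map-injective xs ≢s k k′ eq)

  unique-index-zip-map : ∀ {q} (Q : A × B → Set q) xs → AllPairs _≢_ xs → ∀ {w} → w ∈ xs → Q (w , h w) →
                         (∀ {v} → v ∈ xs → Q (v , h v) → v ≡ w) →
                         Σ (Fin (length (graph xs))) λ k → Q (lookup (graph xs) k)
                           × (∀ k′ → Q (lookup (graph xs) k′) → k′ ≡ k)
  unique-index-zip-map Q xs distinct w∈ Qw only-w with index-zip-map xs w∈
  ... | k , lookup≡ = k , subst Q (sym lookup≡) Qw , unique
    where
    unique : ∀ k′ → Q (lookup (graph xs) k′) → k′ ≡ k
    unique k′ Qk′ with lookup-zip-map xs k′
    ... | v , v∈ , lookup′≡ = lookup-zip-map-injective xs distinct k′ k
      (trans (cong proj₁ lookup′≡) (trans (only-w v∈ (subst Q lookup′≡ Qk′)) (sym (cong proj₁ lookup≡))))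

ListsBelow : ∀ {ℓ} → (ℕ → Set ℓ) → ℕ → List ℕ → Set ℓ
ListsBelow C n xs = All (_< n) xs × (∀ p → p < n → C p ⇔ p ∈ xs)

module _ {ℓ : Level} {C : ℕ → Set ℓ} {n : ℕ} {xs : List ℕ} where

  ListsBelow-snoc : ListsBelow C n xs → C n → ListsBelow C (suc n) (xs ++ [ n ])
  ListsBelow-snoc (xs<n , lists) Cn = All.++⁺ (All.map m<n⇒m<1+n xs<n) (n<1+n n ∷ []) , lists′
    where
    lists′ : ∀ p → p < suc n → C p ⇔ p ∈ xs ++ [ n ]
    lists′ p p<1+n with m<1+n⇒m<n∨m≡n p<1+n
    ... | inj₂ refl = mk⇔ (λ _ → ∈-++⁺ʳ xs (here refl)) (λ _ → Cn)
    ... | inj₁ p<n  = mk⇔ (∈-++⁺ˡ ∘ Equivalence.to (lists p p<n)) from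
      where
      from : p ∈ xs ++ [ n ] → C p
      from p∈ with ∈-++⁻ xs p∈
      ... | inj₁ p∈xs        = Equivalence.from (lists p p<n) p∈xs
      ... | inj₂ (here refl) = ⊥-elim (<-irrefl refl p<n)

  ListsBelow-skip : ListsBelow C n xs → ¬ C n → ListsBelow C (suc n) xs
  ListsBelow-skip (xs<n , lists) ¬Cn = All.map m<n⇒m<1+n xs<n , lists′
    where
    lists′ : ∀ p → p < suc n → C p ⇔ p ∈ xs
    lists′ p p<1+n with m<1+n⇒m<n∨m≡n p<1+n
    ... | inj₁ p<n  = lists p p<n
    ... | inj₂ refl = mk⇔ (⊥-elim ∘ ¬Cn) (λ n∈ → ⊥-elim (<-irrefl refl (All.lookup xs<n n∈)))

-- Binary trees, paths and subtrees

data Ordered {ℓ} (Q : ℕ → Side → ℕ → Set ℓ) : BT → Set ℓ where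
  leaf : ∀ {x} → Ordered Q (lf x)
  node : ∀ {l z r} → All (Q z L) (inorder l) → All (Q z R) (inorder r) →
         Ordered Q l → Ordered Q r → Ordered Q (nd l z r)

Ordered-map : ∀ {ℓ ℓ′} {Q : ℕ → Side → ℕ → Set ℓ} {Q′ : ℕ → Side → ℕ → Set ℓ′} →
              (∀ {q s y} → Q q s y → Q′ q s y) → ∀ {t} → Ordered Q t → Ordered Q′ t
Ordered-map Q⇒Q′ leaf               = leaf
Ordered-map Q⇒Q′ (node Ql Qr ol or) =
  node (All.map Q⇒Q′ Ql) (All.map Q⇒Q′ Qr) (Ordered-map Q⇒Q′ ol) (Ordered-map Q⇒Q′ or)

Beside : ℕ → Side → ℕ → Set
Beside q L y = y < q
Beside q R y = q < y

Beside⇒≢ : ∀ q s y → Beside q s y → y ≢ q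
Beside⇒≢ q L y y<q = <⇒≢ y<q
Beside⇒≢ q R y q<y = <⇒≢ q<y ∘ sym

SearchTree : BT → Set
SearchTree = Ordered Beside

root∈inorder : ∀ t → root t ∈ inorder t
root∈inorder (lf x)     = here refl
root∈inorder (nd l z r) = ∈-++⁺ʳ (inorder l) (here refl)

inorder-nonempty : ∀ t → Σ ℕ λ w → Σ (List ℕ) λ ws → inorder t ≡ w ∷ ws
inorder-nonempty (lf x)     = x , [] , refl
inorder-nonempty (nd l z r) with w , ws , eq ← inorder-nonempty l =
  w , ws ++ z ∷ inorder r , cong (_++ z ∷ inorder r) eq

[x]≢inorder-nd : ∀ {x} l z r → [ x ] ≢ inorder (nd l z r)
[x]≢inorder-nd l z r eq with w , ws , eq′ ← inorder-nonempty l
  with () ← ++-conicalʳ ws _ (sym (∷-injectiveʳ (trans eq (cong (_++ z ∷ inorder r) eq′))))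

leaf∈inorder : ∀ t {w} → w ∈ leaves t → w ∈ inorder t
leaf∈inorder (lf x)     w∈ = w∈
leaf∈inorder (nd l z r) w∈ with ∈-++⁻ (leaves l) w∈
... | inj₁ w∈l = ∈-++⁺ˡ (leaf∈inorder l w∈l)
... | inj₂ w∈r = ∈-++⁺ʳ (inorder l) (there (leaf∈inorder r w∈r))

SearchTree⇒sorted : ∀ {t} → SearchTree t → AllPairs _<_ (inorder t)
SearchTree⇒sorted leaf = [] ∷ []
SearchTree⇒sorted (node l<z z<r sl sr) =
  AllPairs.++⁺ (SearchTree⇒sorted sl) (z<r ∷ SearchTree⇒sorted sr)
    (All.map (λ x<z → x<z ∷ All.map (<-trans x<z) z<r) l<z)

sorted⇒SearchTree : ∀ t → AllPairs _<_ (inorder t) → SearchTree t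
sorted⇒SearchTree (lf x)     _ = leaf
sorted⇒SearchTree (nd l z r) sorted with AllPairs-++⁻ (inorder l) sorted
... | sl , (z<r ∷ sr) , l<zr = node (All.map All.head l<zr) z<r (sorted⇒SearchTree l sl) (sorted⇒SearchTree r sr)

leaves-sorted : ∀ {t} → SearchTree t → AllPairs _<_ (leaves t)
leaves-sorted {lf x} leaf = [] ∷ []
leaves-sorted {nd l z r} (node l<z z<r sl sr) =
  AllPairs.++⁺ (leaves-sorted sl) (leaves-sorted sr)
    (All.tabulate λ u∈ → All.tabulate λ v∈ →
      <-trans (All.lookup l<z (leaf∈inorder l u∈)) (All.lookup z<r (leaf∈inorder r v∈)))

module _ {l : BT} {z : ℕ} {r : BT} where

  ∈-right⇒∉-left : SearchTree (nd l z r) → ∀ {q} → q ∈ inorder r → ¬ q ∈ inorder l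
  ∈-right⇒∉-left (node l<z z<r _ _) q∈r q∈l = <-asym (All.lookup l<z q∈l) (All.lookup z<r q∈r)

  root∉left : SearchTree (nd l z r) → ¬ z ∈ inorder l
  root∉left (node l<z _ _ _) z∈l = <-irrefl refl (All.lookup l<z z∈l)

  root∉right : SearchTree (nd l z r) → ¬ z ∈ inorder r
  root∉right (node _ z<r _ _) z∈r = <-irrefl refl (All.lookup z<r z∈r)

downPath-complete : ∀ t x → x ∈ inorder t → Σ (List (ℕ × Side)) λ p → downPath t x ≡ just p
downPath-complete (lf y) x (here refl) with y ≟ y
... | yes _   = [] , refl
... | no y≢y = ⊥-elim (y≢y refl)
downPath-complete (nd l z r) x x∈ with z ≟ x
... | yes _ = [] , refl
... | no z≢x with downPath l x in el
...   | just p  = _ , refl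
...   | nothing with downPath r x in er
...     | just p  = _ , refl
...     | nothing with ∈-++⁻ (inorder l) x∈
...       | inj₁ x∈l          with () ← trans (sym el) (proj₂ (downPath-complete l x x∈l))
...       | inj₂ (here x≡z)   = ⊥-elim (z≢x (sym x≡z))
...       | inj₂ (there x∈r)  with () ← trans (sym er) (proj₂ (downPath-complete r x x∈r))

downPath-∉ : ∀ t x → ¬ x ∈ inorder t → downPath t x ≡ nothing
downPath-∉ (lf y) x x∉ with y ≟ x
... | yes refl = ⊥-elim (x∉ (here refl))
... | no _     = refl
downPath-∉ (nd l z r) x x∉ with z ≟ x
... | yes refl = ⊥-elim (x∉ (root∈inorder (nd l z r)))
... | no _ with downPath l x in el
...   | just _  with () ← trans (sym (downPath-∉ l x (x∉ ∘ ∈-++⁺ˡ))) el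
...   | nothing with downPath r x in er
...     | just _  with () ← trans (sym (downPath-∉ r x (x∉ ∘ ∈-++⁺ʳ (inorder l) ∘ there))) er
...     | nothing = refl

downPath-sound : ∀ t x p → downPath t x ≡ just p → x ∈ inorder t × All (λ e → proj₁ e ∈ inorder t) p
downPath-sound (lf y) x p eq with y ≟ x
downPath-sound (lf y) x .[] refl | yes refl = here refl , []
downPath-sound (nd l z r) x p eq with z ≟ x
downPath-sound (nd l z r) x .[] refl | yes refl = root∈inorder (nd l z r) , []
... | no _ with downPath l x in el
downPath-sound (nd l z r) x .((z , L) ∷ p) refl | no _ | just p with downPath-sound l x p el
... | x∈ , p⊆ = ∈-++⁺ˡ x∈ , root∈inorder (nd l z r) ∷ All.map ∈-++⁺ˡ p⊆
downPath-sound (nd l z r) x p eq | no _ | nothing with downPath r x in er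
downPath-sound (nd l z r) x .((z , R) ∷ p) refl | no _ | nothing | just p with downPath-sound r x p er
... | x∈ , p⊆ = ∈-++⁺ʳ (inorder l) (there x∈) , root∈inorder (nd l z r) ∷ All.map (∈-++⁺ʳ (inorder l) ∘ there) p⊆

subtreeAt-complete : ∀ t x → x ∈ inorder t → Σ BT λ s → subtreeAt t x ≡ just s
subtreeAt-complete (lf y) x (here refl) with y ≟ y
... | yes _   = _ , refl
... | no y≢y = ⊥-elim (y≢y refl)
subtreeAt-complete (nd l z r) x x∈ with z ≟ x
... | yes _ = _ , refl
... | no z≢x with subtreeAt l x in el
...   | just s  = s , refl
...   | nothing with ∈-++⁻ (inorder l) x∈
...     | inj₁ x∈l         with () ← trans (sym el) (proj₂ (subtreeAt-complete l x x∈l))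
...     | inj₂ (here x≡z)  = ⊥-elim (z≢x (sym x≡z))
...     | inj₂ (there x∈r) = subtreeAt-complete r x x∈r

subtreeAt-∉ : ∀ t x → ¬ x ∈ inorder t → subtreeAt t x ≡ nothing
subtreeAt-∉ (lf y) x x∉ with y ≟ x
... | yes refl = ⊥-elim (x∉ (here refl))
... | no _     = refl
subtreeAt-∉ (nd l z r) x x∉ with z ≟ x
... | yes refl = ⊥-elim (x∉ (root∈inorder (nd l z r)))
... | no _ with subtreeAt l x in el
...   | just _  with () ← trans (sym (subtreeAt-∉ l x (x∉ ∘ ∈-++⁺ˡ))) el
...   | nothing = subtreeAt-∉ r x (x∉ ∘ ∈-++⁺ʳ (inorder l) ∘ there)

record IsSubtree (t s : BT) (q : ℕ) : Set where
  field
    root≡    : root s ≡ q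
    inorder⊆ : ∀ {w} → w ∈ inorder s → w ∈ inorder t
    leaves⊆  : ∀ {w} → w ∈ leaves s → w ∈ leaves t

  root∈ : q ∈ inorder s
  root∈ = subst (_∈ inorder s) root≡ (root∈inorder s)

subtreeAt-sound : ∀ t q s → subtreeAt t q ≡ just s → IsSubtree t s q
subtreeAt-sound (lf y) q s eq with y ≟ q
subtreeAt-sound (lf y) q .(lf y) refl | yes refl = record { root≡ = refl ; inorder⊆ = λ w∈ → w∈ ; leaves⊆ = λ w∈ → w∈ }
subtreeAt-sound (nd l z r) q s eq with z ≟ q
subtreeAt-sound (nd l z r) q .(nd l z r) refl | yes refl =
  record { root≡ = refl ; inorder⊆ = λ w∈ → w∈ ; leaves⊆ = λ w∈ → w∈ }
... | no _ with subtreeAt l q in el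
subtreeAt-sound (nd l z r) q .s refl | no _ | just s = record
  { root≡ = root≡ ; inorder⊆ = ∈-++⁺ˡ ∘ inorder⊆ ; leaves⊆ = ∈-++⁺ˡ ∘ leaves⊆ }
  where open IsSubtree (subtreeAt-sound l q s el)
subtreeAt-sound (nd l z r) q s eq | no _ | nothing = record
  { root≡ = root≡ ; inorder⊆ = ∈-++⁺ʳ (inorder l) ∘ there ∘ inorder⊆ ; leaves⊆ = ∈-++⁺ʳ (leaves l) ∘ leaves⊆ }
  where open IsSubtree (subtreeAt-sound r q s eq)

subtreeAt-just⇒∈ : ∀ t q s → subtreeAt t q ≡ just s → q ∈ inorder t
subtreeAt-just⇒∈ t q s eq = inorder⊆ root∈
  where open IsSubtree (subtreeAt-sound t q s eq)

subtreeAt-Ordered : ∀ {ℓ} {Q : ℕ → Side → ℕ → Set ℓ} {t} q s → Ordered Q t → subtreeAt t q ≡ just s → Ordered Q s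
subtreeAt-Ordered {t = lf y} q s o eq with y ≟ q
subtreeAt-Ordered {t = lf y} q .(lf y) o refl | yes _ = o
subtreeAt-Ordered {t = nd l z r} q s o eq with z ≟ q
subtreeAt-Ordered {t = nd l z r} q .(nd l z r) o refl | yes _ = o
subtreeAt-Ordered {t = nd l z r} q s (node _ _ ol or) eq | no _ with subtreeAt l q in el
subtreeAt-Ordered {t = nd l z r} q .s (node _ _ ol or) refl | no _ | just s = subtreeAt-Ordered q s ol el
... | nothing = subtreeAt-Ordered q s or eq

subtreeAt-root : ∀ l z r → subtreeAt (nd l z r) z ≡ just (nd l z r)
subtreeAt-root l z r with z ≟ z
... | yes _   = refl
... | no z≢z = ⊥-elim (z≢z refl)

module _ {l : BT} {z : ℕ} {r : BT} (st : SearchTree (nd l z r)) where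

  subtreeAt-left : ∀ q → q ∈ inorder l → subtreeAt (nd l z r) q ≡ subtreeAt l q
  subtreeAt-left q q∈l with z ≟ q
  ... | yes refl = ⊥-elim (root∉left st q∈l)
  ... | no _ with subtreeAt l q in el
  ...   | just _  = refl
  ...   | nothing with () ← trans (sym el) (proj₂ (subtreeAt-complete l q q∈l))

  subtreeAt-right : ∀ q → q ∈ inorder r → subtreeAt (nd l z r) q ≡ subtreeAt r q
  subtreeAt-right q q∈r with z ≟ q
  ... | yes refl = ⊥-elim (root∉right st q∈r)
  ... | no _ with subtreeAt l q in el
  ...   | just _  with () ← trans (sym (subtreeAt-∉ l q (∈-right⇒∉-left st q∈r))) el
  ...   | nothing = refl

  downPath-left : ∀ x p → x ∈ inorder l → downPath l x ≡ just p → downPath (nd l z r) x ≡ just ((z , L) ∷ p)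
  downPath-left x p x∈l eq with z ≟ x
  ... | yes refl = ⊥-elim (root∉left st x∈l)
  ... | no _ rewrite eq = refl

  downPath-right : ∀ x p → x ∈ inorder r → downPath r x ≡ just p → downPath (nd l z r) x ≡ just ((z , R) ∷ p)
  downPath-right x p x∈r eq with z ≟ x
  ... | yes refl = ⊥-elim (root∉right st x∈r)
  ... | no _ rewrite downPath-∉ l x (∈-right⇒∉-left st x∈r) | eq = refl

subtreeAt-trans : ∀ t y s q → SearchTree t → subtreeAt t y ≡ just s → q ∈ inorder s → subtreeAt t q ≡ subtreeAt s q
subtreeAt-trans (lf x) y s q _ eq q∈ with x ≟ y
subtreeAt-trans (lf x) y .(lf x) q _ refl q∈ | yes _ = refl
subtreeAt-trans (nd l z r) y s q st eq q∈ with z ≟ y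
subtreeAt-trans (nd l z r) y .(nd l z r) q st refl q∈ | yes _ = refl
... | no _ with subtreeAt l y in el | st
subtreeAt-trans (nd l z r) y .s q st refl q∈ | no _ | just s | node _ _ sl _ =
  trans (subtreeAt-left st q (IsSubtree.inorder⊆ (subtreeAt-sound l y s el) q∈)) (subtreeAt-trans l y s q sl el q∈)
subtreeAt-trans (nd l z r) y s q st eq q∈ | no _ | nothing | node _ _ _ sr =
  trans (subtreeAt-right st q (IsSubtree.inorder⊆ (subtreeAt-sound r y s eq) q∈)) (subtreeAt-trans r y s q sr eq q∈)

downPath-through : ∀ t y s x → SearchTree t → subtreeAt t y ≡ just s → x ∈ inorder s → x ≢ y →
  Σ (List (ℕ × Side)) λ above → Σ Side λ side → Σ (List (ℕ × Side)) λ below →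
    downPath t x ≡ just (above ++ (y , side) ∷ below) × All (λ e → proj₁ e ∈ inorder s) below
downPath-through (lf x₀) y s x _ eq x∈ x≢y with x₀ ≟ y
downPath-through (lf x₀) y .(lf x₀) x _ refl (here refl) x≢y | yes refl = ⊥-elim (x≢y refl)
downPath-through (nd l z r) y s x st eq x∈ x≢y with z ≟ y
downPath-through (nd l z r) y .(nd l z r) x st refl x∈ x≢y | yes refl with ∈-++⁻ (inorder l) x∈
... | inj₁ x∈l with p , el ← downPath-complete l x x∈l =
  [] , L , p , downPath-left st x p x∈l el , All.map ∈-++⁺ˡ (proj₂ (downPath-sound l x p el))
... | inj₂ (here x≡z) = ⊥-elim (x≢y x≡z)
... | inj₂ (there x∈r) with p , er ← downPath-complete r x x∈r =
  [] , R , p , downPath-right st x p x∈r er , All.map (∈-++⁺ʳ (inorder l) ∘ there) (proj₂ (downPath-sound r x p er))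
downPath-through (nd l z r) y s x st eq x∈ x≢y | no _ with subtreeAt l y in el | st
downPath-through (nd l z r) y .s x st refl x∈ x≢y | no _ | just s | node _ _ sl _
  with above , side , below , e , below⊆ ← downPath-through l y s x sl el x∈ x≢y =
  (z , L) ∷ above , side , below , downPath-left st x _ (IsSubtree.inorder⊆ (subtreeAt-sound l y s el) x∈) e , below⊆
downPath-through (nd l z r) y s x st eq x∈ x≢y | no _ | nothing | node _ _ _ sr
  with above , side , below , e , below⊆ ← downPath-through r y s x sr eq x∈ x≢y =
  (z , R) ∷ above , side , below , downPath-right st x _ (IsSubtree.inorder⊆ (subtreeAt-sound r y s eq) x∈) e , below⊆

InSubtreeOf : BT → ℕ → ℕ → Set
InSubtreeOf t q x = Σ BT λ s → subtreeAt t q ≡ just s × x ∈ inorder s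

downPath-ancestors : ∀ t x p → SearchTree t → downPath t x ≡ just p → All (λ e → InSubtreeOf t (proj₁ e) x) p
downPath-ancestors (lf y) x p _ eq with y ≟ x
downPath-ancestors (lf y) x .[] _ refl | yes refl = []
downPath-ancestors (nd l z r) x p st eq with z ≟ x
downPath-ancestors (nd l z r) x .[] st refl | yes refl = []
... | no _ with downPath l x in el | st
downPath-ancestors (nd l z r) x .((z , L) ∷ p) st refl | no _ | just p | node _ _ sl _ with downPath-sound l x p el
... | x∈l , p⊆l = (_ , subtreeAt-root l z r , ∈-++⁺ˡ x∈l)
  ∷ All.zipWith (λ { (q∈l , (s , e , x∈s)) → s , trans (subtreeAt-left st _ q∈l) e , x∈s })
                (p⊆l , downPath-ancestors l x p sl el)
downPath-ancestors (nd l z r) x p st eq | no _ | nothing | node _ _ _ sr with downPath r x in er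
downPath-ancestors (nd l z r) x .((z , R) ∷ p) st refl | no _ | nothing | node _ _ _ sr | just p
  with downPath-sound r x p er
... | x∈r , p⊆r = (_ , subtreeAt-root l z r , ∈-++⁺ʳ (inorder l) (there x∈r))
  ∷ All.zipWith (λ { (q∈r , (s , e , x∈s)) → s , trans (subtreeAt-right st _ q∈r) e , x∈s })
                (p⊆r , downPath-ancestors r x p sr er)

subtreeAt-leaf : ∀ t y s → SearchTree t → y ∈ leaves t → subtreeAt t y ≡ just s → s ≡ lf y
subtreeAt-leaf (lf x) y s _ _ eq with x ≟ y
subtreeAt-leaf (lf x) y .(lf x) _ _ refl | yes refl = refl
subtreeAt-leaf (nd l z r) y s st y∈ eq with z ≟ y
subtreeAt-leaf (nd l z r) y .(nd l z r) st y∈ refl | yes refl with ∈-++⁻ (leaves l) y∈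
... | inj₁ z∈l = ⊥-elim (root∉left st (leaf∈inorder l z∈l))
... | inj₂ z∈r = ⊥-elim (root∉right st (leaf∈inorder r z∈r))
subtreeAt-leaf (nd l z r) y s st y∈ eq | no _ with subtreeAt l y in el | st
subtreeAt-leaf (nd l z r) y .s st y∈ refl | no _ | just s | node _ _ sl _ with ∈-++⁻ (leaves l) y∈
... | inj₁ y∈l = subtreeAt-leaf l y s sl y∈l el
... | inj₂ y∈r = ⊥-elim (∈-right⇒∉-left st (leaf∈inorder r y∈r) (subtreeAt-just⇒∈ l y s el))
subtreeAt-leaf (nd l z r) y s st y∈ eq | no _ | nothing | node _ _ _ sr with ∈-++⁻ (leaves l) y∈
... | inj₁ y∈l = ⊥-elim (∈-right⇒∉-left st (subtreeAt-just⇒∈ r y s eq) (leaf∈inorder l y∈l))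
... | inj₂ y∈r = subtreeAt-leaf r y s sr y∈r eq

module _ {ℓ : Level} {Q : ℕ → Side → ℕ → Set ℓ} where

  AboveBy : ℕ × Side → ℕ × Side → Set ℓ
  AboveBy (q , s) (y , _) = Q q s y

  downPath-Ordered : ∀ t x p → Ordered Q t → downPath t x ≡ just p → AllPairs AboveBy (p ++ [ (x , L) ])
  downPath-Ordered (lf y) x p _ eq with y ≟ x
  downPath-Ordered (lf y) x .[] _ refl | yes refl = [] ∷ []
  downPath-Ordered (nd l z r) x p o eq with z ≟ x
  downPath-Ordered (nd l z r) x .[] o refl | yes refl = [] ∷ []
  ... | no _ with downPath l x in el | o
  downPath-Ordered (nd l z r) x .((z , L) ∷ p) o refl | no _ | just p | node Ql _ ol _ with downPath-sound l x p el
  ... | x∈l , p⊆l = All.++⁺ (All.map (All.lookup Ql) p⊆l) (All.lookup Ql x∈l ∷ []) ∷ downPath-Ordered l x p ol el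
  downPath-Ordered (nd l z r) x p o eq | no _ | nothing | node _ Qr _ or with downPath r x in er
  downPath-Ordered (nd l z r) x .((z , R) ∷ p) o refl | no _ | nothing | node _ Qr _ or | just p
    with downPath-sound r x p er
  ... | x∈r , p⊆r = All.++⁺ (All.map (All.lookup Qr) p⊆r) (All.lookup Qr x∈r ∷ []) ∷ downPath-Ordered r x p or er

module _ {ℓ : Level} where

  All-sel : ∀ {P : ℕ → Set ℓ} sd pre → All (λ (q , s) → s ≡ sd → P q) pre → All P (sel sd pre)
  All-sel sd       []             []         = []
  All-sel L ((q , L) ∷ pre) (Pq ∷ Ps) = Pq refl ∷ All-sel L pre Ps
  All-sel L ((q , R) ∷ pre) (_  ∷ Ps) = All-sel L pre Ps
  All-sel R ((q , L) ∷ pre) (_  ∷ Ps) = All-sel R pre Ps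
  All-sel R ((q , R) ∷ pre) (Pq ∷ Ps) = Pq refl ∷ All-sel R pre Ps

  AllPairs-sel : ∀ {Q : ℕ → ℕ → Set ℓ} sd pre →
                 AllPairs (λ (q , s) (q′ , s′) → s ≡ sd → s′ ≡ sd → Q q q′) pre → AllPairs Q (sel sd pre)
  AllPairs-sel sd []              []         = []
  AllPairs-sel L ((q , L) ∷ pre) (Qq ∷ Qs) = All-sel L pre (All.map (_$ refl) Qq) ∷ AllPairs-sel L pre Qs
  AllPairs-sel L ((q , R) ∷ pre) (_  ∷ Qs) = AllPairs-sel L pre Qs
  AllPairs-sel R ((q , L) ∷ pre) (_  ∷ Qs) = AllPairs-sel R pre Qs
  AllPairs-sel R ((q , R) ∷ pre) (Qq ∷ Qs) = All-sel R pre (All.map (_$ refl) Qq) ∷ AllPairs-sel R pre Qs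

-- The perturbed map f

module BananaTree {a ℓ₁ ℓ₂ : Level} (O : StrictTotalOrder a ℓ₁ ℓ₂) (m : ℕ) (c : ℕ → StrictTotalOrder.Carrier O) where

  open Banana O m c
  open StrictTotalOrder O using (_≈_; compare)
  module O = StrictTotalOrder O

  <S-trans : ∀ {s t u} → s <S t → t <S u → s <S u
  <S-trans n<z z<p = n<p

  _<S?_ : ∀ s t → Dec (s <S t)
  neg <S? neg = no λ ()
  neg <S? zer = yes n<z
  neg <S? pos = yes n<p
  zer <S? neg = no λ ()
  zer <S? zer = no λ ()
  zer <S? pos = yes z<p
  pos <S? _   = no λ ()

  <E-trans : ∀ {u v w} → u <E v → v <E w → u <E w
  <E-trans (v<v x<y)   (v<v y<z)    = v<v (O.trans x<y y<z)
  <E-trans (v<v x<y)   (v≈v y≈z _)  = v<v (O.<-respʳ-≈ y≈z x<y)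
  <E-trans (v≈v x≈y _) (v<v y<z)    = v<v (O.<-respˡ-≈ (O.Eq.sym x≈y) y<z)
  <E-trans (v≈v x≈y s) (v≈v y≈z t)  = v≈v (O.Eq.trans x≈y y≈z) (<S-trans s t)
  <E-trans (v<v _)     v<top        = v<top
  <E-trans (v≈v _ _)   v<top        = v<top

  <E-irrefl : ∀ {u} → ¬ (u <E u)
  <E-irrefl (v<v x<x)   = O.irrefl O.Eq.refl x<x
  <E-irrefl (v≈v _ ())

  <E-asym : ∀ {u v} → u <E v → ¬ (v <E u)
  <E-asym u<v v<u = <E-irrefl (<E-trans u<v v<u)

  _<E?_ : ∀ u v → Dec (u <E v)
  val x s <E? val y t with compare x y
  ... | tri< x<y _ _   = yes (v<v x<y)
  ... | tri> x≮y x≉y _ = no λ { (v<v x<y) → x≮y x<y ; (v≈v x≈y _) → x≉y x≈y }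
  ... | tri≈ x≮y x≈y _ with s <S? t
  ...   | yes s<t = yes (v≈v x≈y s<t)
  ...   | no s≮t  = no λ { (v<v x<y) → x≮y x<y ; (v≈v _ s<t) → s≮t s<t }
  val x s <E? top     = yes v<top
  top     <E? val y t = no λ ()
  top     <E? top     = no λ ()

  <S-trichotomy : ∀ s t → s <S t ⊎ t <S s ⊎ s ≡ t
  <S-trichotomy neg neg = inj₂ (inj₂ refl)
  <S-trichotomy neg zer = inj₁ n<z
  <S-trichotomy neg pos = inj₁ n<p
  <S-trichotomy zer neg = inj₂ (inj₁ n<z)
  <S-trichotomy zer zer = inj₂ (inj₂ refl)
  <S-trichotomy zer pos = inj₁ z<p
  <S-trichotomy pos neg = inj₂ (inj₁ n<p)
  <S-trichotomy pos zer = inj₂ (inj₁ z<p)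
  <S-trichotomy pos pos = inj₂ (inj₂ refl)

  sgn≡zer⇒≈ : ∀ x y → sgn x y ≡ zer → x ≈ y
  sgn≡zer⇒≈ x y eq with compare x y
  ... | tri≈ _ x≈y _ = x≈y

  data View : ℕ → Ext → Set a where
    hook₀ : View 0 (val (c 1) (sgn (c 1) (c 2)))
    inner : ∀ {p} → 1 ≤ p → p ≤ m → View p (val (c p) zer)
    hookₘ : View (suc m) (val (c m) (sgn (c m) (c (m ∸ 1))))

  f-inner : ∀ p → 1 ≤ p → p ≤ m → f p ≡ val (c p) zer
  f-inner (suc n) _ p≤m with suc n ≤? m
  ... | yes _   = refl
  ... | no p≰m = ⊥-elim (p≰m p≤m)

  f-hookₘ : f (suc m) ≡ val (c m) (sgn (c m) (c (m ∸ 1)))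
  f-hookₘ with suc m ≤? m
  ... | yes m<m = ⊥-elim (<-irrefl refl m<m)
  ... | no _ with suc m ≟ suc m
  ...   | yes _    = refl
  ...   | no m≢m = ⊥-elim (m≢m refl)

  f-β : f β ≡ top
  f-β with suc (suc m) ≤? m
  ... | yes m+2≤m = ⊥-elim (<-irrefl refl (≤-trans (n<1+n (suc m)) (m≤n⇒m≤1+n m+2≤m)))
  ... | no _ with suc (suc m) ≟ suc m
  ...   | yes m+2≡m+1 = ⊥-elim (<⇒≢ (n<1+n (suc m)) (sym m+2≡m+1))
  ...   | no _        = refl

  view : ∀ p → p ≤ suc m → View p (f p)
  view zero    _ = hook₀
  view (suc p) p≤ with suc p ≟ suc m
  ... | yes refl = subst (View (suc m)) (sym f-hookₘ) hookₘ
  ... | no p≢    = subst (View (suc p)) (sym (f-inner (suc p) (s≤s z≤n) p≤m)) (inner (s≤s z≤n) p≤m)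
    where
    p≤m : suc p ≤ m
    p≤m = ≤-pred (≤∧≢⇒< p≤ p≢)

  f<top : ∀ p → p ≤ suc m → f p <E top
  f<top p p≤ = below-top (view p p≤)
    where
    below-top : ∀ {p u} → View p u → u <E top
    below-top hook₀     = v<top
    below-top (inner _ _) = v<top
    below-top hookₘ     = v<top

  module Construction (2≤m : 2 ≤ m)
                      (distinct : ∀ i j → 1 ≤ i → i ≤ m → 1 ≤ j → j ≤ m → i ≢ j → ¬ c i ≈ c j) where

    private
      1≤m : 1 ≤ m
      1≤m = ≤-trans (s≤s z≤n) 2≤m

      c-injective : ∀ {i j} → 1 ≤ i → i ≤ m → 1 ≤ j → j ≤ m → c i ≈ c j → i ≡ j
      c-injective {i} {j} 1≤i i≤m 1≤j j≤m ci≈cj with i ≟ j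
      ... | yes i≡j = i≡j
      ... | no i≢j  = ⊥-elim (distinct i j 1≤i i≤m 1≤j j≤m i≢j ci≈cj)

      c₁≉cₘ : ¬ c 1 ≈ c m
      c₁≉cₘ c₁≈cₘ = <-irrefl (c-injective ≤-refl 1≤m 1≤m ≤-refl c₁≈cₘ) 2≤m

      hook₀-sign≢zer : sgn (c 1) (c 2) ≢ zer
      hook₀-sign≢zer eq with () ← c-injective ≤-refl 1≤m (s≤s z≤n) 2≤m (sgn≡zer⇒≈ _ _ eq)

      hookₘ-sign≢zer : sgn (c m) (c (m ∸ 1)) ≢ zer
      hookₘ-sign≢zer eq =
        <-irrefl (sym (c-injective 1≤m ≤-refl (∸-monoˡ-≤ 1 2≤m) (m∸n≤m m 1) (sgn≡zer⇒≈ _ _ eq)))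
                 (∸-monoʳ-< {m} {1} {0} (s≤s z≤n) 1≤m)

    view-injective : ∀ {p q x y s t} → View p (val x s) → View q (val y t) → x ≈ y → s ≡ t → p ≡ q
    view-injective hook₀         hook₀         _     _    = refl
    view-injective hook₀         (inner _ _)   _     s≡t  = ⊥-elim (hook₀-sign≢zer s≡t)
    view-injective hook₀         hookₘ         x≈y   _    = ⊥-elim (c₁≉cₘ x≈y)
    view-injective (inner _ _)   hook₀         _     s≡t  = ⊥-elim (hook₀-sign≢zer (sym s≡t))
    view-injective (inner 1≤p p≤m) (inner 1≤q q≤m) x≈y _ = c-injective 1≤p p≤m 1≤q q≤m x≈y
    view-injective (inner _ _)   hookₘ         _     s≡t  = ⊥-elim (hookₘ-sign≢zer (sym s≡t))
    view-injective hookₘ         hook₀         x≈y   _    = ⊥-elim (c₁≉cₘ (O.Eq.sym x≈y))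
    view-injective hookₘ         (inner _ _)   _     s≡t  = ⊥-elim (hookₘ-sign≢zer s≡t)
    view-injective hookₘ         hookₘ         _     _    = refl

    f-comparable : ∀ p q → p ≤ suc m → q ≤ suc m → p ≢ q → f p <E f q ⊎ f q <E f p
    f-comparable p q p≤ q≤ p≢q = comparable (view p p≤) (view q q≤)
      where
      comparable : ∀ {u v} → View p u → View q v → u <E v ⊎ v <E u
      comparable {val x s} {val y t} vp vq with compare x y
      ... | tri< x<y _ _ = inj₁ (v<v x<y)
      ... | tri> _ _ y<x = inj₂ (v<v y<x)
      ... | tri≈ _ x≈y _ with <S-trichotomy s t
      ...   | inj₁ s<t        = inj₁ (v≈v x≈y s<t)
      ...   | inj₂ (inj₁ t<s) = inj₂ (v≈v (O.Eq.sym x≈y) t<s)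
      ...   | inj₂ (inj₂ s≡t) = ⊥-elim (p≢q (view-injective vp vq x≈y s≡t))

    f-≮⇒> : ∀ p q → p ≤ suc m → q ≤ suc m → p ≢ q → ¬ f p <E f q → f q <E f p
    f-≮⇒> p q p≤ q≤ p≢q fp≮fq with f-comparable p q p≤ q≤ p≢q
    ... | inj₁ fp<fq = ⊥-elim (fp≮fq fp<fq)
    ... | inj₂ fq<fp = fq<fp

    -- ascent n says whether f increases into position n; beyond the hooks f is treated as +∞, so
    -- the critical items are exactly the positions where the ascent flips.
    ascent : ℕ → Bool
    ascent zero    = false
    ascent (suc n) with n ≤? m
    ... | yes _ = does (f n <E? f (suc n))
    ... | no _  = true

    ascent-true : ∀ n → n ≤ m → ascent (suc n) ≡ true → f n <E f (suc n)
    ascent-true n n≤m eq with n ≤? m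
    ... | no n≰m = ⊥-elim (n≰m n≤m)
    ... | yes _ with f n <E? f (suc n)
    ...   | yes fn<fn+1 = fn<fn+1

    ascent-false : ∀ n → n ≤ m → ascent (suc n) ≡ false → f (suc n) <E f n
    ascent-false n n≤m eq with n ≤? m
    ... | no n≰m = ⊥-elim (n≰m n≤m)
    ... | yes _ with f n <E? f (suc n)
    ...   | no fn≮fn+1 = f-≮⇒> n (suc n) (m≤n⇒m≤1+n n≤m) (s≤s n≤m) (<⇒≢ (n<1+n n)) fn≮fn+1

    <⇒ascent-true : ∀ n → n ≤ m → f n <E f (suc n) → ascent (suc n) ≡ true
    <⇒ascent-true n n≤m fn<fn+1 with n ≤? m
    ... | no n≰m = ⊥-elim (n≰m n≤m)
    ... | yes _ with f n <E? f (suc n)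
    ...   | yes _        = refl
    ...   | no fn≮fn+1 = ⊥-elim (fn≮fn+1 fn<fn+1)

    >⇒ascent-false : ∀ n → n ≤ m → f (suc n) <E f n → ascent (suc n) ≡ false
    >⇒ascent-false n n≤m fn+1<fn with n ≤? m
    ... | no n≰m = ⊥-elim (n≰m n≤m)
    ... | yes _ with f n <E? f (suc n)
    ...   | yes fn<fn+1 = ⊥-elim (<E-asym fn+1<fn fn<fn+1)
    ...   | no _        = refl

    ascent-β : ascent β ≡ true
    ascent-β with suc m ≤? m
    ... | yes m<m = ⊥-elim (<-irrefl refl m<m)
    ... | no _    = refl

    Valley Peak : ℕ → Set
    Valley n = ascent n ≡ false × ascent (suc n) ≡ true
    Peak   n = ascent n ≡ true × ascent (suc n) ≡ false

    critical⇒≤ : ∀ {n} → Critical n → n ≤ suc m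
    critical⇒≤ (intMin _ _ n≤m _ _) = m≤n⇒m≤1+n n≤m
    critical⇒≤ (intMax _ _ n≤m _ _) = m≤n⇒m≤1+n n≤m
    critical⇒≤ (hookMin₀ _)         = z≤n
    critical⇒≤ (hookMinₘ _)         = ≤-refl

    critical⇒turn : ∀ {n} → Critical n → Valley n ⊎ Peak n
    critical⇒turn (intMin (suc k) _ k<m fn<fk fn<fn+1) =
      inj₁ (>⇒ascent-false k (<⇒≤ k<m) fn<fk , <⇒ascent-true (suc k) k<m fn<fn+1)
    critical⇒turn (intMax (suc k) _ k<m fk<fn fn+1<fn) =
      inj₂ (<⇒ascent-true k (<⇒≤ k<m) fk<fn , >⇒ascent-false (suc k) k<m fn+1<fn)
    critical⇒turn (hookMin₀ f0<f1)   = inj₁ (refl , <⇒ascent-true 0 z≤n f0<f1)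
    critical⇒turn (hookMinₘ fm+1<fm) = inj₁ (>⇒ascent-false m ≤-refl fm+1<fm , ascent-β)

    level⇒¬critical : ∀ {n} → ascent n ≡ ascent (suc n) → ¬ Critical n
    level⇒¬critical level crit with critical⇒turn crit
    ... | inj₁ (down , up) with () ← trans (sym down) (trans level up)
    ... | inj₂ (up , down) with () ← trans (sym up) (trans level down)

    valley⇒critical : ∀ n → n ≤ suc m → Valley n → Critical n
    valley⇒critical zero    _   (_ , up)    = hookMin₀ (ascent-true 0 z≤n up)
    valley⇒critical (suc k) k≤ (down , up) with m≤n⇒m<n∨m≡n k≤
    ... | inj₁ (s≤s k<m) =
      intMin (suc k) (s≤s z≤n) k<m (ascent-false k (<⇒≤ k<m) down) (ascent-true (suc k) k<m up)
    ... | inj₂ refl      = hookMinₘ (ascent-false m ≤-refl down)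

    peak⇒critical : ∀ n → n ≤ suc m → Peak n → Critical n
    peak⇒critical zero    _  (() , _)
    peak⇒critical (suc k) k≤ (up , down) with m≤n⇒m<n∨m≡n k≤
    ... | inj₁ (s≤s k<m) =
      intMax (suc k) (s≤s z≤n) k<m (ascent-true k (<⇒≤ k<m) up) (ascent-false (suc k) k<m down)
    ... | inj₂ refl      with () ← trans (sym ascent-β) down

    -- Cartesian trees

    Hangs : ℕ → Side → ℕ → Set (a ⊔ ℓ₁ ⊔ ℓ₂)
    Hangs q s y = Beside q s y × f y <E f q

    Cartesian : BT → Set (a ⊔ ℓ₁ ⊔ ℓ₂)
    Cartesian = Ordered Hangs

    Cartesian⇒SearchTree : ∀ {t} → Cartesian t → SearchTree t
    Cartesian⇒SearchTree = Ordered-map proj₁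

    _≼_ : ℕ → ℕ → Set (a ⊔ ℓ₁ ⊔ ℓ₂)
    w ≼ z = w ≡ z ⊎ f w <E f z

    ≼-antisym : ∀ {w z} → w ≼ z → z ≼ w → w ≡ z
    ≼-antisym (inj₁ w≡z)  _            = w≡z
    ≼-antisym (inj₂ _)    (inj₁ z≡w)   = sym z≡w
    ≼-antisym (inj₂ w<z)  (inj₂ z<w)   = ⊥-elim (<E-asym w<z z<w)

    ≼-<E-trans : ∀ {w z} u → w ≼ z → f z <E f u → f w <E f u
    ≼-<E-trans _ (inj₁ refl) z<u = z<u
    ≼-<E-trans _ (inj₂ w<z)  z<u = <E-trans w<z z<u

    CondI2⇒root-max : ∀ t → CondI2 t → All (_≼ root t) (inorder t)
    CondI2⇒root-max (lf x)     _                   = inj₁ refl ∷ []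
    CondI2⇒root-max (nd l z r) (l<z , r<z , hl , hr) =
      All.++⁺ (All.map (λ w≼ → inj₂ (≼-<E-trans z w≼ l<z)) (CondI2⇒root-max l hl))
              (inj₁ refl ∷ All.map (λ w≼ → inj₂ (≼-<E-trans z w≼ r<z)) (CondI2⇒root-max r hr))

    Cartesian⇒CondI2 : ∀ {t} → Cartesian t → CondI2 t
    Cartesian⇒CondI2 leaf = lift tt
    Cartesian⇒CondI2 {nd l z r} (node Hl Hr cl cr) =
        proj₂ (All.lookup Hl (root∈inorder l)) , proj₂ (All.lookup Hr (root∈inorder r))
      , Cartesian⇒CondI2 cl , Cartesian⇒CondI2 cr

    cartesian : ∀ {t} → SearchTree t → CondI2 t → Cartesian t
    cartesian leaf _ = leaf
    cartesian {nd l z r} (node l<z z<r sl sr) (fl<fz , fr<fz , hl , hr) =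
      node (All.zipWith (λ (w<z , w≼) → w<z , ≼-<E-trans z w≼ fl<fz) (l<z , CondI2⇒root-max l hl))
           (All.zipWith (λ (z<w , w≼) → z<w , ≼-<E-trans z w≼ fr<fz) (z<r , CondI2⇒root-max r hr))
           (cartesian sl hl) (cartesian sr hr)

    Cartesian-root-max : ∀ {t} → Cartesian t → All (_≼ root t) (inorder t)
    Cartesian-root-max {t} ct = CondI2⇒root-max t (Cartesian⇒CondI2 ct)

    Cartesian-unique : ∀ {t t′} → Cartesian t → Cartesian t′ → inorder t ≡ inorder t′ → t ≡ t′
    Cartesian-unique {lf x}     {lf x′}        _  _  eq = cong lf (∷-injectiveˡ eq)
    Cartesian-unique {lf x}     {nd l′ z′ r′}  _  _  eq = ⊥-elim ([x]≢inorder-nd l′ z′ r′ eq)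
    Cartesian-unique {nd l z r} {lf x′}        _  _  eq = ⊥-elim ([x]≢inorder-nd l z r (sym eq))
    Cartesian-unique {nd l z r} {nd l′ z′ r′} ct@(node Hl _ cl cr) ct′@(node Hl′ _ cl′ cr′) eq
      with ≼-antisym (All.lookup (Cartesian-root-max ct′) (subst (z ∈_) eq (root∈inorder (nd l z r))))
                     (All.lookup (Cartesian-root-max ct) (subst (z′ ∈_) (sym eq) (root∈inorder (nd l′ z′ r′))))
    ... | refl with ∷-cancel-at (inorder l) (inorder l′) (All.map (<⇒≢ ∘ proj₁) Hl) (All.map (<⇒≢ ∘ proj₁) Hl′) eq
    ...   | eql , eqr = cong₂ (λ u v → nd u z v) (Cartesian-unique cl cl′ eql) (Cartesian-unique cr cr′ eqr)

    lastNode : BT → ℕ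
    lastNode (lf x)     = x
    lastNode (nd _ _ r) = lastNode r

    insert : BT → ℕ → ℕ → BT
    insert (lf z)     y x = nd (lf z) y (lf x)
    insert (nd l z r) y x with f y <E? f z
    ... | yes _ = nd l z (insert r y x)
    ... | no _  = nd (nd l z r) y (lf x)

    inorder-insert : ∀ t y x → inorder (insert t y x) ≡ inorder t ++ y ∷ x ∷ []
    inorder-insert (lf z)     y x = refl
    inorder-insert (nd l z r) y x with f y <E? f z
    ... | yes _ = trans (cong (λ u → inorder l ++ z ∷ u) (inorder-insert r y x))
                        (sym (++-assoc (inorder l) (z ∷ inorder r) _))
    ... | no _  = refl

    lastNode-insert : ∀ t y x → lastNode (insert t y x) ≡ x
    lastNode-insert (lf z)     y x = refl
    lastNode-insert (nd l z r) y x with f y <E? f z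
    ... | yes _ = lastNode-insert r y x
    ... | no _  = refl

    insert-Cartesian : ∀ {t} y x → Cartesian t → All (_< y) (inorder t) → y < x → y ≤ suc m →
                       f (lastNode t) <E f y → f x <E f y → Cartesian (insert t y x)
    insert-Cartesian {lf z} y x _ (z<y ∷ []) y<x _ fz<fy fx<fy =
      node ((z<y , fz<fy) ∷ []) ((y<x , fx<fy) ∷ []) leaf leaf
    insert-Cartesian {nd l z r} y x ct@(node Hl Hr cl cr) t<y y<x y≤ fr<fy fx<fy with f y <E? f z
    ... | yes fy<fz = node Hl Hr′ cl (insert-Cartesian y x cr r<y y<x y≤ fr<fy fx<fy)
      where
      z<y : z < y
      z<y = All.lookup t<y (root∈inorder (nd l z r))
      r<y : All (_< y) (inorder r)
      r<y = All.++⁻ʳ (z ∷ []) (All.++⁻ʳ (inorder l) t<y)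
      Hr′ : All (Hangs z R) (inorder (insert r y x))
      Hr′ rewrite inorder-insert r y x = All.++⁺ Hr ((z<y , fy<fz) ∷ (<-trans z<y y<x , <E-trans fx<fy fy<fz) ∷ [])
    ... | no fy≮fz =
      node (All.zipWith (λ (w<y , w≼z) → w<y , ≼-<E-trans y w≼z fz<fy) (t<y , Cartesian-root-max ct))
           ((y<x , fx<fy) ∷ []) ct leaf
      where
      z<y : z < y
      z<y = All.lookup t<y (root∈inorder (nd l z r))
      fz<fy : f z <E f y
      fz<fy = f-≮⇒> y z y≤ (<⇒≤ (≤-trans z<y y≤)) (<⇒≢ z<y ∘ sym) fy≮fz

    -- The state after reading the positions below n: no minimum yet, or the Cartesian tree of the
    -- critical items read so far, possibly with a last maximum y waiting for the next minimum.
    data Scan : Set where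
      start   : Scan
      rising  : BT → Scan
      falling : BT → ℕ → Scan

    items : Scan → List ℕ
    items start         = []
    items (rising t)    = inorder t
    items (falling t y) = inorder t ++ [ y ]

    direction : Scan → Bool
    direction start         = false
    direction (rising _)    = true
    direction (falling _ _) = false

    advance : ℕ → Bool → Scan → Scan
    advance n true  start         = rising (lf n)
    advance n false start         = start
    advance n true  (rising t)    = rising t
    advance n false (rising t)    = falling t n
    advance n true  (falling t y) = rising (insert t y n)
    advance n false (falling t y) = falling t y

    scan : ℕ → Scan
    scan zero    = start
    scan (suc n) = advance n (ascent (suc n)) (scan n)

    Shape : ℕ → Scan → Set (a ⊔ ℓ₁ ⊔ ℓ₂)
    Shape n start         = Lift _ ⊤
    Shape n (rising t)    = Cartesian t × (n ≤ suc m → f (lastNode t) <E f n)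
    Shape n (falling t y) = Cartesian t × All (_< y) (inorder t) × f (lastNode t) <E f y × (n ≤ suc m → f n <E f y)

    record Invariant (n : ℕ) (s : Scan) : Set (a ⊔ ℓ₁ ⊔ ℓ₂) where
      constructor invariant
      field
        ascent≡ : ascent n ≡ direction s
        listed  : ListsBelow Critical n (items s)
        shape   : Shape n s

    advance-Invariant : ∀ n s → n ≤ suc m → Invariant n s → Invariant (suc n) (advance n (ascent (suc n)) s)
    advance-Invariant n s n≤ inv with ascent (suc n) in next
    advance-Invariant n start n≤ (invariant down listed _) | true =
      invariant next (ListsBelow-snoc listed (valley⇒critical n n≤ (down , next)))
                (leaf , λ n<m+1 → ascent-true n (≤-pred n<m+1) next)
    advance-Invariant n start n≤ (invariant down listed _) | false =
      invariant next (ListsBelow-skip listed (level⇒¬critical (trans down (sym next)))) (lift tt)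
    advance-Invariant n (rising t) n≤ (invariant up listed (ct , fl<fn)) | true =
      invariant next (ListsBelow-skip listed (level⇒¬critical (trans up (sym next))))
                (ct , λ n<m+1 → <E-trans (fl<fn n≤) (ascent-true n (≤-pred n<m+1) next))
    advance-Invariant n (rising t) n≤ (invariant up listed (ct , fl<fn)) | false =
      invariant next (ListsBelow-snoc listed (peak⇒critical n n≤ (up , next)))
                (ct , proj₁ listed , fl<fn n≤ , λ n<m+1 → ascent-false n (≤-pred n<m+1) next)
    advance-Invariant n (falling t y) n≤ (invariant down listed (ct , t<y , fl<fy , fn<fy)) | true =
      invariant next listed′ (insert-Cartesian y n ct t<y y<n y≤ fl<fy (fn<fy n≤) , fl′<fn+1)
      where
      y<n : y < n
      y<n = All.lookup (proj₁ listed) (∈-++⁺ʳ (inorder t) (here refl))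
      y≤ : y ≤ suc m
      y≤ = <⇒≤ (≤-trans y<n n≤)
      listed′ : ListsBelow Critical (suc n) (inorder (insert t y n))
      listed′ rewrite inorder-insert t y n | sym (++-assoc (inorder t) [ y ] [ n ]) =
        ListsBelow-snoc listed (valley⇒critical n n≤ (down , next))
      fl′<fn+1 : suc n ≤ suc m → f (lastNode (insert t y n)) <E f (suc n)
      fl′<fn+1 (s≤s n≤m) rewrite lastNode-insert t y n = ascent-true n n≤m next
    advance-Invariant n (falling t y) n≤ (invariant down listed (ct , t<y , fl<fy , fn<fy)) | false =
      invariant next (ListsBelow-skip listed (level⇒¬critical (trans down (sym next))))
                (ct , t<y , fl<fy , λ n<m+1 → <E-trans (ascent-false n (≤-pred n<m+1) next) (fn<fy n≤))

    scan-Invariant : ∀ n → n ≤ β → Invariant n (scan n)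
    scan-Invariant zero    _   = invariant refl ([] , λ _ ()) (lift tt)
    scan-Invariant (suc n) n<β = advance-Invariant n (scan n) (≤-pred n<β) (scan-Invariant n (<⇒≤ n<β))

    finished : ∀ {s} → Invariant β s → Σ BT λ t → Invariant β (rising t)
    finished {start}       (invariant down _ _) with () ← trans (sym ascent-β) down
    finished {rising t}    inv                  = t , inv
    finished {falling _ _} (invariant down _ _) with () ← trans (sym ascent-β) down

    abstract
      T : BT
      T = proj₁ (finished (scan-Invariant β ≤-refl))

      T-Invariant : Invariant β (rising T)
      T-Invariant = proj₂ (finished (scan-Invariant β ≤-refl))

    T-Cartesian : Cartesian T
    T-Cartesian = proj₁ (Invariant.shape T-Invariant)

    T-SearchTree : SearchTree T
    T-SearchTree = Cartesian⇒SearchTree T-Cartesian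

    T-critical : ∀ p → Critical p ⇔ p ∈ inorder T
    T-critical p = mk⇔ (λ cp → Equivalence.to (lists p (s≤s (critical⇒≤ cp))) cp)
                       (λ p∈ → Equivalence.from (lists p (All.lookup T<β p∈)) p∈)
      where
      open Invariant T-Invariant using (listed)
      T<β : All (_< β) (inorder T)
      T<β = proj₁ listed
      lists : ∀ p → p < β → Critical p ⇔ p ∈ inorder T
      lists = proj₂ listed

    T-bounded : All (_≤ suc m) (inorder T)
    T-bounded = All.tabulate (critical⇒≤ ∘ Equivalence.from (T-critical _))

    T-CondI1 : CondI1 T
    T-CondI1 = AllPairs⇒Linked (SearchTree⇒sorted T-SearchTree)
             , λ p → Equivalence.from (T-critical p) , Equivalence.to (T-critical p)

    T-unique : ∀ t′ → CondI1 t′ → CondI2 t′ → T ≡ t′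
    T-unique t′ (linked , critical⇔) heap =
      Cartesian-unique T-Cartesian (cartesian (sorted⇒SearchTree t′ sorted′) heap)
        (strictlySorted-⊆⊇⇒≡ (SearchTree⇒sorted T-SearchTree) sorted′
          (proj₂ (critical⇔ _) ∘ Equivalence.from (T-critical _))
          (Equivalence.to (T-critical _) ∘ proj₁ (critical⇔ _)))
      where
      sorted′ : AllPairs _<_ (inorder t′)
      sorted′ = Linked⇒AllPairs <-trans linked

    -- Partners: Condition II

    minLeaf : BT → ℕ
    minLeaf (lf x)     = x
    minLeaf (nd l z r) with f (minLeaf l) <E? f (minLeaf r)
    ... | yes _ = minLeaf l
    ... | no _  = minLeaf r

    minLeaf∈leaves : ∀ t → minLeaf t ∈ leaves t
    minLeaf∈leaves (lf x)     = here refl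
    minLeaf∈leaves (nd l z r) with f (minLeaf l) <E? f (minLeaf r)
    ... | yes _ = ∈-++⁺ˡ (minLeaf∈leaves l)
    ... | no _  = ∈-++⁺ʳ (leaves l) (minLeaf∈leaves r)

    ≼-trans : ∀ {u v w} → u ≼ v → v ≼ w → u ≼ w
    ≼-trans (inj₁ refl) v≼w         = v≼w
    ≼-trans u≼v         (inj₁ refl) = u≼v
    ≼-trans (inj₂ u<v)  (inj₂ v<w)  = inj₂ (<E-trans u<v v<w)

    minLeaf-min : ∀ {t} → Cartesian t → All (_≤ suc m) (inorder t) → All (minLeaf t ≼_) (inorder t)
    minLeaf-min {lf x} _ _ = inj₁ refl ∷ []
    minLeaf-min {nd l z r} ct@(node Hl Hr cl cr) bounded with All.++⁻ (inorder l) bounded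
    ... | l≤ , (_ ∷ r≤) with f (minLeaf l) <E? f (minLeaf r)
    ...   | yes fl<fr =
      All.++⁺ (minLeaf-min cl l≤)
              (inj₂ (proj₂ (All.lookup Hl ml∈l)) ∷ All.map (≼-trans (inj₂ fl<fr)) (minLeaf-min cr r≤))
      where
      ml∈l : minLeaf l ∈ inorder l
      ml∈l = leaf∈inorder l (minLeaf∈leaves l)
    ...   | no fl≮fr =
      All.++⁺ (All.map (≼-trans (inj₂ fr<fl)) (minLeaf-min cl l≤))
              (inj₂ (proj₂ (All.lookup Hr mr∈r)) ∷ minLeaf-min cr r≤)
      where
      ml∈l : minLeaf l ∈ inorder l
      ml∈l = leaf∈inorder l (minLeaf∈leaves l)
      mr∈r : minLeaf r ∈ inorder r
      mr∈r = leaf∈inorder r (minLeaf∈leaves r)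
      fr<fl : f (minLeaf r) <E f (minLeaf l)
      fr<fl = f-≮⇒> (minLeaf l) (minLeaf r) (All.lookup l≤ ml∈l) (All.lookup r≤ mr∈r)
                    (λ eq → ∈-right⇒∉-left (Cartesian⇒SearchTree ct) mr∈r (subst (_∈ inorder l) eq ml∈l)) fl≮fr

    NotMin? : ∀ t x q → Dec (NotMin t x q)
    NotMin? t x q with subtreeAt t q
    ... | nothing = no λ ()
    ... | just s  = Dec.map′ (λ below → s , refl , find below) from (any? (λ y → f y <E? f x) (inorder s))
      where
      from : Σ BT (λ s′ → just s ≡ just s′ × Σ ℕ λ y → y ∈ inorder s′ × f y <E f x) →
             Any (λ y → f y <E f x) (inorder s)
      from (s , refl , y , y∈ , fy<fx) = lose y∈ fy<fx

    StopsAt : ℕ → ℕ × Side → Set (a ⊔ ℓ₁ ⊔ ℓ₂)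
    StopsAt x = NotMin T x ∘ proj₁

    StopsAt? : ∀ x e → Dec (StopsAt x e)
    StopsAt? x = NotMin? T x ∘ proj₁

    partnerSplit : ∀ x p → FirstHit (StopsAt x) (reverse p ++ [ (β , L) ])
    partnerSplit x p = firstHit (StopsAt? x) (reverse p) (β , L)

    partner : ℕ → ℕ
    partner x with downPath T x
    ... | just p  = proj₁ (FirstHit.hit (partnerSplit x p))
    ... | nothing = β

    up-just : ∀ t x p → downPath t x ≡ just p → up t x ≡ reverse p ++ [ (β , L) ]
    up-just t x p eq rewrite eq = refl

    up-partner : ∀ x p → downPath T x ≡ just p →
                 up T x ≡ FirstHit.before (partnerSplit x p) ++ (partner x , proj₂ (FirstHit.hit (partnerSplit x p)))
                                                            ∷ FirstHit.after (partnerSplit x p)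
    up-partner x p eq rewrite eq = FirstHit.split (partnerSplit x p)

    partner-Partner : ∀ x → x ∈ inorder T → Partner T x (partner x)
    partner-Partner x x∈ with p , eq ← downPath-complete T x x∈ =
      before , proj₂ hit , after , up-partner x p eq , misses , stops′
      where
      open FirstHit (partnerSplit x p)
      stops′ : NotMin T x (partner x) ⊎ (partner x ≡ β × after ≡ [])
      stops′ rewrite eq with stops
      ... | inj₁ notMin    = inj₁ notMin
      ... | inj₂ after≡[] = inj₂ (cong proj₁ (firstHit-last (StopsAt? x) (reverse p) (β , L) after≡[]) , after≡[])

    Partner-functional : ∀ {t x b b′} → Partner t x b → Partner t x b′ → b ≡ b′
    Partner-functional (pre , _ , _ , split , misses , stops) (pre′ , _ , _ , split′ , misses′ , stops′) =
      cong proj₁ (first-hit-unique pre pre′ (trans (sym split) split′) misses misses′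
                                   (Sum.map₂ proj₂ stops) (Sum.map₂ proj₂ stops′))

    -- Trails: Condition III

    Beneath : ℕ × Side → ℕ × Side → Set (a ⊔ ℓ₁ ⊔ ℓ₂)
    Beneath = flip (AboveBy {Q = Hangs})

    β-hangs : ∀ {q} → q ∈ inorder T → Hangs β L q
    β-hangs {q} q∈ = s≤s q≤ , subst (f q <E_) (sym f-β) (f<top q q≤)
      where
      q≤ : q ≤ suc m
      q≤ = All.lookup T-bounded q∈

    up-chain : ∀ x → x ∈ inorder T → AllPairs Beneath ((x , L) ∷ up T x)
    up-chain x x∈ with p , eq ← downPath-complete T x x∈ =
      subst (AllPairs Beneath) (trans reverse≡ (cong ((x , L) ∷_) (sym (up-just T x p eq))))
        (AllPairs-reverse⁺ (All.++⁺ (All.map β-hangs (proj₂ (downPath-sound T x p eq))) (β-hangs x∈ ∷ [])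
                            ∷ downPath-Ordered T x p T-Cartesian eq))
      where
      reverse≡ : reverse ((β , L) ∷ p ++ [ (x , L) ]) ≡ (x , L) ∷ reverse p ++ [ (β , L) ]
      reverse≡ = trans (unfold-reverse (β , L) (p ++ [ (x , L) ]))
                       (cong (_++ [ (β , L) ]) (reverse-++ p [ (x , L) ]))

    trail-chain : ∀ {x b s} pre {post} → AllPairs Beneath ((x , L) ∷ pre ++ (b , s) ∷ post) → ∀ sd →
                  AllPairs (λ u v → Hangs v sd u) (x ∷ sel sd pre) × All (Hangs b s) (x ∷ sel sd pre)
    trail-chain pre (x-below ∷ chain) sd with pre-chain , _ , pre-below ← AllPairs-++⁻ pre chain =
        All-sel sd pre (All.map (λ h → λ { refl → h }) (All.++⁻ˡ pre x-below))
          ∷ AllPairs-sel sd pre (AllPairs.map (λ h _ → λ { refl → h }) pre-chain)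
      , All.head (All.++⁻ʳ pre x-below) ∷ All-sel sd pre (All.map (λ h _ → All.head h) pre-below)

    module _ {x b s} pre {post} (chain : AllPairs Beneath ((x , L) ∷ pre ++ (b , s) ∷ post)) where

      x-hangs : Hangs b s x
      x-hangs = All.head (All.++⁻ʳ pre (AllPairs.head chain))

      trail-positions : ∀ sd → Linked (λ u v → Beside v sd u) (x ∷ sel sd pre)
      trail-positions sd = AllPairs⇒Linked (AllPairs.map proj₁ (proj₁ (trail-chain pre chain sd)))

      trail-values : ∀ sd → Linked (λ u v → f u <E f v) (x ∷ sel sd pre ++ [ b ])
      trail-values sd = AllPairs-snoc⇒Linked (AllPairs.map proj₂ (proj₁ (trail-chain pre chain sd)))
                                             (All.map proj₂ (proj₂ (trail-chain pre chain sd)))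

      trail-hangs : Linked (λ u v → Hangs v s u) (x ∷ sel s pre ++ [ b ])
      trail-hangs = AllPairs-snoc⇒Linked (proj₁ (trail-chain pre chain s)) (proj₂ (trail-chain pre chain s))

    trail-conditions : ∀ x b s pre post → AllPairs Beneath ((x , L) ∷ pre ++ (b , s) ∷ post) → TrailConds x b pre
    trail-conditions x b L pre post chain =
        (λ _ → (trail-positions pre chain R , trail-values pre chain R) , trail-hangs pre chain)
      , (λ b<x → ⊥-elim (<-asym b<x (proj₁ (x-hangs pre chain))))
    trail-conditions x b R pre post chain =
        (λ x<b → ⊥-elim (<-asym x<b (proj₁ (x-hangs pre chain))))
      , (λ _ → (trail-positions pre chain L , trail-values pre chain L) , trail-hangs pre chain)

    up-distinct : ∀ x → x ∈ inorder T → AllPairs (_≢_ on proj₁) (up T x)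
    up-distinct x x∈ =
      AllPairs.map (λ {e} {e′} → Beside⇒≢ (proj₁ e′) (proj₂ e′) (proj₁ e) ∘ proj₁) (AllPairs.tail (up-chain x x∈))

    up-ancestors : ∀ x p → downPath T x ≡ just p → All (λ e → proj₁ e ≡ β ⊎ InSubtreeOf T (proj₁ e) x) (up T x)
    up-ancestors x p eq rewrite up-just T x p eq =
      All.++⁺ (All-reverse⁺ (All.map inj₂ (downPath-ancestors T x p T-SearchTree eq))) (inj₁ refl ∷ [])

    module _ {y : ℕ} (y∈ : y ∈ inorder T) where

      private
        S : BT
        S = proj₁ (subtreeAt-complete T y y∈)
        S-at : subtreeAt T y ≡ just S
        S-at = proj₂ (subtreeAt-complete T y y∈)
        open IsSubtree (subtreeAt-sound T y S S-at)
        x₀ : ℕ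
        x₀ = minLeaf S
        x₀∈S : x₀ ∈ inorder S
        x₀∈S = leaf∈inorder S (minLeaf∈leaves S)
        x₀-min : All (x₀ ≼_) (inorder S)
        x₀-min = minLeaf-min (subtreeAt-Ordered y S T-Cartesian S-at) (All.tabulate (All.lookup T-bounded ∘ inorder⊆))

      x₀-stays-inside : ∀ {q} → q ∈ inorder S → ¬ NotMin T x₀ q
      x₀-stays-inside q∈S (s , s-at , w , w∈s , fw<fx₀) = <E-irrefl (≼-<E-trans x₀ (All.lookup x₀-min w∈S) fw<fx₀)
        where
        s-at′ : subtreeAt S _ ≡ just s
        s-at′ = trans (sym (subtreeAt-trans T y S _ T-SearchTree S-at q∈S)) s-at
        w∈S : w ∈ inorder S
        w∈S = IsSubtree.inorder⊆ (subtreeAt-sound S _ s s-at′) w∈s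

      minLeaf-on-path : OnPath T (x₀ , partner x₀) y
      minLeaf-on-path with p , eq ← downPath-complete T x₀ (inorder⊆ x₀∈S) =
        before , proj₂ hit , after , up-partner x₀ p eq , y-on-path
        where
        open FirstHit (partnerSplit x₀ p)
        y-on-path : y ≡ x₀ ⊎ y ∈ map proj₁ before
        y-on-path with y ≟ x₀
        ... | yes y≡x₀ = inj₁ y≡x₀
        ... | no y≢x₀
          with above , side , below , eq′ , below⊆S ← downPath-through T y S x₀ T-SearchTree S-at x₀∈S (y≢x₀ ∘ sym)
          with refl ← just-injective (trans (sym eq) eq′) =
          inj₂ (∈-map⁺ proj₁ (subst (λ v → (y , side) ∈ FirstHit.before (firstHit (StopsAt? x₀) v (β , L)))
                                   (sym (reverse-++-∷ above (y , side) below))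
                                   (firstHit-passes (StopsAt? x₀) (reverse below) (y , side) (reverse above) (β , L)
                                      (All-reverse⁺ (All.map x₀-stays-inside below⊆S)) (x₀-stays-inside root∈))))

      on-path⇒minLeaf : ∀ {w} → w ∈ leaves T → OnPath T (w , partner w) y → w ≡ x₀
      on-path⇒minLeaf w∈ (_ , _ , _ , _ , inj₁ refl) =
        cong minLeaf (sym (subtreeAt-leaf T y S T-SearchTree w∈ S-at))
      on-path⇒minLeaf {w} w∈ (pre′ , _ , _ , eq′ , inj₂ y∈pre′)
        with p , eq ← downPath-complete T w (leaf∈inorder T w∈) | e , e∈pre′ , refl ← ∈-map⁻ proj₁ y∈pre′ =
        ancestor (All.lookup (All.++⁻ˡ pre′ (subst (All _) eq′ (up-ancestors w p eq))) e∈pre′)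
        where
        open FirstHit (partnerSplit w p)
        pre′≡before : pre′ ≡ before
        pre′≡before = prefix-unique proj₁ pre′ before (subst (AllPairs _) eq′ (up-distinct w (leaf∈inorder T w∈)))
                                    (trans (sym eq′) (up-partner w p eq)) refl
        y-passed : ¬ NotMin T w y
        y-passed = All.lookup misses (subst (e ∈_) pre′≡before e∈pre′)
        ancestor : y ≡ β ⊎ InSubtreeOf T y w → w ≡ x₀
        ancestor (inj₁ y≡β) = ⊥-elim (<-irrefl y≡β (s≤s (All.lookup T-bounded y∈)))
        ancestor (inj₂ (S′ , S′-at , w∈S′))
          with refl ← just-injective (trans (sym S-at) S′-at) with All.lookup x₀-min w∈S′
        ... | inj₁ x₀≡w    = sym x₀≡w
        ... | inj₂ fx₀<fw = ⊥-elim (y-passed (S , S-at , x₀ , x₀∈S , fx₀<fw))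

      edge-owner : Σ (Fin (length (graph partner (leaves T)))) λ k → OnPath T (lookup (graph partner (leaves T)) k) y
                     × (∀ k′ → OnPath T (lookup (graph partner (leaves T)) k′) y → k′ ≡ k)
      edge-owner = unique-index-zip-map partner (λ e → OnPath T e y) (leaves T)
                     (AllPairs.map <⇒≢ (leaves-sorted T-SearchTree)) (leaves⊆ (minLeaf∈leaves S))
                     minLeaf-on-path on-path⇒minLeaf

    D : List ℕ
    D = map partner (leaves T)

    T-CondII : CondII T D
    T-CondII = All⇒Pointwise-map partner (All.tabulate (partner-Partner _ ∘ leaf∈inorder T)) , λ _ → edge-owner

    T-CondIII : CondIII T D
    T-CondIII x b xb∈ pre s post eq = trail-conditions x b s pre post
      (subst (λ u → AllPairs Beneath ((x , L) ∷ u)) eq (up-chain x (leaf∈inorder T (∈-zip⁻ˡ (leaves T) D xb∈))))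

    D-unique : ∀ D′ → CondII T D′ → D ≡ D′
    D-unique D′ (partners′ , _) = Pointwise-functional (Partner-functional {T}) (proj₁ T-CondII) partners′

lemma3p2 : ∀ {a ℓ₁ ℓ₂} (O : StrictTotalOrder a ℓ₁ ℓ₂) (m : ℕ) (c : ℕ → StrictTotalOrder.Carrier O) →
    2 ≤ m →
    (∀ i j → 1 ≤ i → i ≤ m → 1 ≤ j → j ≤ m → i ≢ j → ¬ StrictTotalOrder._≈_ O (c i) (c j)) →
    Σ (BT × List ℕ) (λ (t , D) →
        (Banana.CondI1 O m c t × Banana.CondI2 O m c t × Banana.CondII O m c t D
          × Banana.CondIII O m c t D)
      × (∀ t′ D′ → Banana.CondI1 O m c t′ → Banana.CondI2 O m c t′ → Banana.CondII O m c t′ D′ →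
           (t , D) ≡ (t′ , D′)))
lemma3p2 O m c 2≤m distinct =
  (T , D) , (T-CondI1 , Cartesian⇒CondI2 T-Cartesian , T-CondII , T-CondIII) , unique
  where
  open Banana O m c using (CondI1; CondI2; CondII)
  open BananaTree.Construction O m c 2≤m distinct
  unique : ∀ t′ D′ → CondI1 t′ → CondI2 t′ → CondII t′ D′ → (T , D) ≡ (t′ , D′)
  unique t′ D′ I1 I2 II with refl ← T-unique t′ I1 I2 = cong (T ,_) (D-unique D′ II)
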